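{- Let $F$ be a graph with $\chi(F)\geq 3$ and let $G$ be an $F$-free $r$-partite graph with parts $V_1,\ldots,V_r$. Let $A,B$ be vertex-disjoint independent sets of $G$ with $|B|\geq|V(F)|$, and let $X=N_G[B]\setminus A$. Then $G_{A\to X}$ is $F$-free. In particular, if $G$ is $K_t$-free, then $G_{V_i}$ is $K_t$-free for every $i\in[r]$.
   Context: $N_G[B]$ denotes the set of common neighbours in $G$ of all vertices of $B$. For disjoint vertex sets $A$ and $S$, $G_{A\to S}$ is the graph obtained from $G$ by deleting all edges incident with $A$ and adding all edges between $A$ and $S$. For an independent set $A$ of $G$, $G_A=G_{A\to N_G(u)}$ where $u$ is a vertex of maximum degree in $G$ among the vertices of $A$. -}

module Defs where

open import Data.Nat using (ℕ; _≤_)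
open import Data.Bool using (Bool; true; false; _∧_; _∨_; not; if_then_else_)
open import Data.Bool.Properties using (∧-zeroʳ)
open import Data.Fin using (Fin; _≟_)
open import Data.Fin.Subset using (Subset; ∣_∣; _∩_; ∁)
open import Data.Vec using (lookup; tabulate)
open import Data.Vec.Properties using (lookup∘tabulate; lookup-zipWith; lookup-map)
open import Data.List.Base using ()
open import Data.Fin.Base using ()
open import Data.Product using (Σ; ∃; _×_; _,_)
open import Data.Empty using (⊥)
open import Relation.Nullary using (¬_)
open import Relation.Nullary.Decidable using (⌊_⌋)
open import Relation.Binary.PropositionalEquality using (_≡_; refl; sym; trans)
open import Function.Definitions using (Injective)
import Data.List as L
open import Data.Fin using (zero; suc)

record Graph (n : ℕ) : Set where
  field
    adj    : Fin n → Fin n → Bool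
    adj-sym : ∀ x y → adj x y ≡ adj y x
    adj-irr : ∀ x → adj x x ≡ false
open Graph public

_∈ₛ_ : ∀ {n} → Fin n → Subset n → Set
x ∈ₛ A = lookup A x ≡ true

Independent : ∀ {n} → Graph n → Subset n → Set
Independent G A = ∀ x y → x ∈ₛ A → y ∈ₛ A → adj G x y ≡ false

Disjoint : ∀ {n} → Subset n → Subset n → Set
Disjoint A S = ∀ x → x ∈ₛ A → x ∈ₛ S → ⊥

nbhd : ∀ {n} → Graph n → Fin n → Subset n
nbhd G u = tabulate (adj G u)

deg : ∀ {n} → Graph n → Fin n → ℕ
deg G u = ∣ nbhd G u ∣

-- N_G[B]: common neighbours of all vertices of B
commonNbhd : ∀ {n} → Graph n → Subset n → Subset n
commonNbhd {n} G B =
  tabulate (λ x → L.foldr (λ y acc → (not (lookup B y) ∨ adj G x y) ∧ acc) true (L.allFin n))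

-- G_{A→S}: delete all edges incident with A, add all edges between A and S
-- (A and S disjoint).
private
  inA : ∀ {n} → Subset n → Fin n → Bool
  inA A x = lookup A x

  modAdj : ∀ {n} → Graph n → Subset n → Subset n → Fin n → Fin n → Bool
  modAdj G A S x y =
    if lookup A x ∨ lookup A y
    then (lookup A x ∧ lookup S y) ∨ (lookup A y ∧ lookup S x)
    else adj G x y

  ∨-comm' : ∀ a b → (a ∨ b) ≡ (b ∨ a)
  ∨-comm' false false = refl
  ∨-comm' false true = refl
  ∨-comm' true false = refl
  ∨-comm' true true = refl

  modSym : ∀ {n} (G : Graph n) A S x y → modAdj G A S x y ≡ modAdj G A S y x
  modSym G A S x y with lookup A x | lookup A y
  ... | false | false = Graph.adj-sym G x y
  ... | false | true  = ∨-comm' false (lookup S x)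
  ... | true  | false = ∨-comm' (lookup S y) false
  ... | true  | true  = ∨-comm' (lookup S y) (lookup S x)

  modIrr : ∀ {n} (G : Graph n) A S → Disjoint A S → ∀ x → modAdj G A S x x ≡ false
  modIrr G A S d x with lookup A x in eqA | lookup S x in eqS
  ... | false | _     = Graph.adj-irr G x
  ... | true  | false = refl
  ... | true  | true  with d x eqA eqS
  ... | ()

_⟶_within_ : ∀ {n} (A S : Subset n) → Graph n → Disjoint A S → Graph n
(A ⟶ S within G) d = record
  { adj    = modAdj G A S
  ; adj-sym = modSym G A S
  ; adj-irr = modIrr G A S d }

diffDisjoint : ∀ {n} (A C : Subset n) → Disjoint A (C ∩ ∁ A)
diffDisjoint A C x xA xS
  rewrite lookup-zipWith _∧_ x C (∁ A) | lookup-map x not A | xA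
  with trans (sym xS) (∧-zeroʳ (lookup C x))
... | ()

nbhdDisjoint : ∀ {n} (G : Graph n) (A : Subset n) (u : Fin n) →
               Independent G A → u ∈ₛ A → Disjoint A (nbhd G u)
nbhdDisjoint G A u ind uA x xA xN
  rewrite lookup∘tabulate (adj G u) x
  with trans (sym xN) (ind u x uA xA)
... | ()

-- G_A = G_{A → N_G(u)} for a vertex u of maximum degree in G among A
MaxDegIn : ∀ {n} → Graph n → Subset n → Fin n → Set
MaxDegIn G A u = u ∈ₛ A × (∀ v → v ∈ₛ A → deg G v ≤ deg G u)

Copy : ∀ {k n} → Graph k → Graph n → Set
Copy F G = Σ (Fin _ → Fin _) λ f →
  Injective _≡_ _≡_ f × (∀ i j → adj F i j ≡ true → adj G (f i) (f j) ≡ true)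

Free : ∀ {k n} → Graph k → Graph n → Set
Free F G = ¬ Copy F G

Colourable : ∀ {k} → Graph k → ℕ → Set
Colourable {k} F m = Σ (Fin k → Fin m) λ c → ∀ i j → adj F i j ≡ true → ¬ (c i ≡ c j)

ChromaticAtLeast3 : ∀ {k} → Graph k → Set
ChromaticAtLeast3 F = ¬ Colourable F 2

K : (t : ℕ) → Graph t
K t = record { adj = λ x y → not ⌊ x ≟ y ⌋ ; adj-sym = s ; adj-irr = ir }
  where
  s : ∀ (x y : Fin t) → not ⌊ x ≟ y ⌋ ≡ not ⌊ y ≟ x ⌋
  s x y with x ≟ y | y ≟ x
  ... | Relation.Nullary.yes _ | Relation.Nullary.yes _ = refl
  ... | Relation.Nullary.no _  | Relation.Nullary.no _  = refl
  ... | Relation.Nullary.yes p | Relation.Nullary.no q with q (sym p)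
  ... | ()
  s x y | Relation.Nullary.no q | Relation.Nullary.yes p with q (sym p)
  ... | ()
  ir : ∀ (x : Fin t) → not ⌊ x ≟ x ⌋ ≡ false
  ir x with x ≟ x
  ... | Relation.Nullary.yes _ = refl
  ... | Relation.Nullary.no q with q refl
  ... | ()

part : ∀ {n r} → (Fin n → Fin r) → Fin r → Subset n
part p i = tabulate (λ x → ⌊ p x ≟ i ⌋)

IsRPartition : ∀ {n r} → Graph n → (Fin n → Fin r) → Set
IsRPartition {r = r} G p = ∀ (i : Fin r) → Independent G (part p i)

-- Take a copy of F in G_{A→S}, where S is disjoint from A.  An edge at a vertex
-- of A ends in S, so the vertices of the copy lying in A are pairwise
-- non-adjacent.  One at a time, move such a vertex onto a vertex b that is
-- complete to S and not yet used; this keeps a copy.  In the first part b ∈ B,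
-- which has at least |V(F)| vertices, all outside A and complete to
-- X ⊆ N_G[B], so every vertex of A is eventually evicted and the copy lies in G.
-- In the second part F = K_t meets A at most once, and that vertex can be moved
-- onto u itself, which in G is complete to S = N_G(u).
module Submission where

open import Defs
open import Data.Nat using (ℕ; zero; suc; _≤_; _<_; z≤n; s≤s)
import Data.Nat as ℕ
open import Data.Nat.Properties using (≤∧≢⇒<; m<1+n⇒m≤n; <⇒≱)
open import Data.Bool using (Bool; true; false; _∧_; _∨_; not)
import Data.Bool as Bool
open import Data.Bool.Properties using (¬-not; ∧-zeroʳ; ∨-identityʳ)
open import Data.Fin using (Fin; toℕ; punchIn; punchOut; _≟_)
open import Data.Fin.Properties
  using (any?; suc-injective; toℕ<n; toℕ-injective; punchIn-punchOut; punchOut-injective)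
open import Data.Fin.Subset using (Subset; ∣_∣; _∩_; ∁)
open import Data.Fin.Subset.Properties using (x∈p∩q⁻)
open import Data.Vec using ([]; _∷_; lookup)
open import Data.Vec.Properties using (lookup∘tabulate; []=⇒lookup; lookup⇒[]=)
open import Data.Vec.Functional using (updateAt)
open import Data.Vec.Functional.Properties using (updateAt-updates; updateAt-minimal)
import Data.List as List
open import Data.List.Relation.Unary.Any using (here; there)
open import Data.List.Membership.Propositional using (_∈_)
open import Data.List.Membership.Propositional.Properties using (∈-allFin)
open import Data.Product using (_×_; _,_; proj₁; proj₂; ∃)
open import Function using (_∘_; const)
open import Function.Definitions using (Injective)
open import Relation.Nullary using (¬_; Dec; yes; no; contradiction)
open import Relation.Nullary.Decidable using (decidable-stable; _×-dec_; ¬?)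
open import Relation.Binary.PropositionalEquality
  using (_≡_; _≢_; refl; sym; trans; cong; subst)

∣p∣≤m-by-injection : ∀ {n m} (B : Subset n) (h : ∀ x → x ∈ₛ B → Fin m) →
  (∀ {x y} (x∈B : x ∈ₛ B) (y∈B : y ∈ₛ B) → h x x∈B ≡ h y y∈B → x ≡ y) →
  ∣ B ∣ ≤ m
∣p∣≤m-by-injection [] h h-inj = z≤n
∣p∣≤m-by-injection (false ∷ B) h h-inj =
  ∣p∣≤m-by-injection B (h ∘ Fin.suc) (λ x∈B y∈B → suc-injective ∘ h-inj x∈B y∈B)
∣p∣≤m-by-injection {m = zero} (true ∷ B) h h-inj with h Fin.zero refl
... | ()
∣p∣≤m-by-injection {m = suc m} (true ∷ B) h h-inj =
  s≤s (∣p∣≤m-by-injection B h′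
        λ x∈B y∈B → suc-injective ∘ h-inj x∈B y∈B ∘ punchOut-injective (h₀≢h x∈B) (h₀≢h y∈B))
  where
  h₀≢h : ∀ {x} (x∈B : x ∈ₛ B) → h Fin.zero refl ≢ h (Fin.suc x) x∈B
  h₀≢h x∈B e with h-inj refl x∈B e
  ... | ()
  h′ : ∀ x → x ∈ₛ B → Fin m
  h′ x x∈B = punchOut (h₀≢h x∈B)

∣p∣≤m-by-covering : ∀ {n m} (B : Subset n) (g : Fin m → Fin n) →
  (∀ x → x ∈ₛ B → ∃ λ j → g j ≡ x) → ∣ B ∣ ≤ m
∣p∣≤m-by-covering B g cover =
  ∣p∣≤m-by-injection B (λ x x∈B → proj₁ (cover x x∈B))
    (λ {x} {y} x∈B y∈B e →
      trans (sym (proj₂ (cover x x∈B))) (trans (cong g e) (proj₂ (cover y y∈B))))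

∃-member-avoiding : ∀ {k n} (B : Subset n) (f : Fin k → Fin n) (i : Fin k) →
  k ≤ ∣ B ∣ → ∃ λ b → b ∈ₛ B × (∀ j → j ≢ i → f j ≢ b)
∃-member-avoiding {suc k} B f i k<∣B∣ = avoid uncovered
  where
  hit? : ∀ b → Dec (∃ λ j → f (punchIn i j) ≡ b)
  hit? b = any? λ j → f (punchIn i j) ≟ b
  uncovered : ∃ λ b → b ∈ₛ B × ¬ (∃ λ j → f (punchIn i j) ≡ b)
  uncovered = decidable-stable (any? λ b → (lookup B b Bool.≟ true) ×-dec ¬? (hit? b))
    λ ∄ → <⇒≱ k<∣B∣ (∣p∣≤m-by-covering B (f ∘ punchIn i)
      λ b b∈B → decidable-stable (hit? b) (λ b∉ → ∄ (b , b∈B , b∉)))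
  avoid : (∃ λ b → b ∈ₛ B × ¬ (∃ λ j → f (punchIn i j) ≡ b)) →
          ∃ λ b → b ∈ₛ B × (∀ j → j ≢ i → f j ≢ b)
  avoid (b , b∈B , b∉) = b , b∈B , λ j j≢i fj≡b →
    b∉ (punchOut (j≢i ∘ sym) , trans (cong f (punchIn-punchOut (j≢i ∘ sym))) fj≡b)

∈ₛ-∩⁻ˡ : ∀ {n x} (p q : Subset n) → x ∈ₛ (p ∩ q) → x ∈ₛ p
∈ₛ-∩⁻ˡ {x = x} p q x∈p∩q = []=⇒lookup (proj₁ (x∈p∩q⁻ p q (lookup⇒[]= x _ x∈p∩q)))

Disjoint⇒∉ˡ : ∀ {n} (A S : Subset n) → Disjoint A S → ∀ {x} → x ∈ₛ S → lookup A x ≡ false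
Disjoint⇒∉ˡ A S A#S {x} x∈S = ¬-not λ x∈A → A#S x x∈A x∈S

foldr-∧-true : ∀ {a} {V : Set a} (P : V → Bool) (xs : List.List V) →
  List.foldr (λ y acc → P y ∧ acc) true xs ≡ true → ∀ {y} → y ∈ xs → P y ≡ true
foldr-∧-true P (z List.∷ xs) all (here refl) with P z | all
... | true | _ = refl
foldr-∧-true P (z List.∷ xs) all (there y∈xs) with P z | all
... | true | all′ = foldr-∧-true P xs all′ y∈xs

commonNbhd-adj : ∀ {n} (G : Graph n) (B : Subset n) {x y} →
  x ∈ₛ commonNbhd G B → y ∈ₛ B → adj G x y ≡ true
commonNbhd-adj {n} G B {x} {y} x∈C y∈B =
  subst (λ β → not β ∨ adj G x y ≡ true) y∈B
    (foldr-∧-true _ (List.allFin n) (trans (sym (lookup∘tabulate _ x)) x∈C) (∈-allFin y))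

CompleteTo : ∀ {n} → Graph n → Fin n → Subset n → Set
CompleteTo G x S = ∀ s → s ∈ₛ S → adj G x s ≡ true

complete-to-commonNbhd : ∀ {n} (G : Graph n) (B : Subset n) {b} → b ∈ₛ B →
  CompleteTo G b (commonNbhd G B)
complete-to-commonNbhd G B {b} b∈B s s∈C = trans (adj-sym G b s) (commonNbhd-adj G B s∈C b∈B)

PreservesEdges : ∀ {k n} → Graph k → Graph n → (Fin k → Fin n) → Set
PreservesEdges F G f = ∀ i j → adj F i j ≡ true → adj G (f i) (f j) ≡ true

module _ {n} (G : Graph n) (A S : Subset n) (A#S : Disjoint A S) where

  private
    G′ : Graph n
    G′ = (A ⟶ S within G) A#S

  adj-⟶-outside : ∀ {x y} → lookup A x ≡ false → lookup A y ≡ false →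
    adj G′ x y ≡ adj G x y
  adj-⟶-outside x∉A y∉A rewrite x∉A | y∉A = refl

  adj-⟶-A-S : ∀ {x y} → x ∈ₛ A → y ∈ₛ S → adj G′ x y ≡ true
  adj-⟶-A-S x∈A y∈S rewrite x∈A | y∈S = refl

  adj-⟶-from-A : ∀ {x y} → x ∈ₛ A → adj G′ x y ≡ true → y ∈ₛ S
  adj-⟶-from-A {x} {y} x∈A e with lookup S x in x∈S
  ... | true  = contradiction x∈S (A#S x x∈A)
  ... | false rewrite x∈A | ∧-zeroʳ (lookup A y) | ∨-identityʳ (lookup S y) = e

  copy-of-⟶ : ∀ {k} (F : Graph k) (f : Fin k → Fin n) → Injective _≡_ _≡_ f →
    PreservesEdges F G′ f → (∀ i → f i ∈ₛ A → CompleteTo G (f i) S) → Copy F G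
  copy-of-⟶ F f f-inj f-edges A-complete = f , f-inj , edges
    where
    edges : PreservesEdges F G f
    edges i j ij with lookup A (f i) in fi∈A | lookup A (f j) in fj∈A
    ... | true  | _     = A-complete i fi∈A (f j) (adj-⟶-from-A fi∈A (f-edges i j ij))
    ... | false | true  = trans (adj-sym G (f i) (f j))
      (A-complete j fj∈A (f i)
        (adj-⟶-from-A fj∈A (trans (adj-sym G′ (f j) (f i))
          (f-edges i j ij))))
    ... | false | false = trans (sym (adj-⟶-outside fi∈A fj∈A)) (f-edges i j ij)

  copy-move : ∀ {k} (F : Graph k) (f : Fin k → Fin n) → Injective _≡_ _≡_ f →
    PreservesEdges F G′ f → ∀ i → f i ∈ₛ A → ∀ b → CompleteTo G′ b S →
    (∀ j → j ≢ i → f j ≢ b) →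
    Injective _≡_ _≡_ (updateAt f i (const b)) × PreservesEdges F G′ (updateAt f i (const b))
  copy-move F f f-inj f-edges i fi∈A b b-complete b-fresh = g-inj , g-edges
    where
    g : Fin _ → Fin n
    g = updateAt f i (const b)
    g-i : g i ≡ b
    g-i = updateAt-updates i f
    g-off : ∀ {j} → j ≢ i → g j ≡ f j
    g-off {j} j≢i = updateAt-minimal j i f j≢i
    b-to : ∀ {j} → adj F i j ≡ true → adj G′ b (f j) ≡ true
    b-to {j} ij = b-complete (f j) (adj-⟶-from-A fi∈A (f-edges i j ij))

    g-inj : Injective _≡_ _≡_ g
    g-inj {x} {y} e with x ≟ i | y ≟ i
    ... | yes refl | yes refl = refl
    ... | yes refl | no y≢i =
      contradiction (trans (sym (g-off y≢i)) (trans (sym e) g-i)) (b-fresh y y≢i)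
    ... | no x≢i | yes refl =
      contradiction (trans (sym (g-off x≢i)) (trans e g-i)) (b-fresh x x≢i)
    ... | no x≢i | no y≢i = f-inj (trans (sym (g-off x≢i)) (trans e (g-off y≢i)))

    g-edges : PreservesEdges F G′ g
    g-edges x y xy with x ≟ i | y ≟ i
    ... | yes refl | yes refl = contradiction (trans (sym (adj-irr F i)) xy) λ ()
    ... | yes refl | no y≢i rewrite g-i | g-off y≢i = b-to xy
    ... | no x≢i | yes refl rewrite g-i | g-off x≢i =
      trans (adj-sym G′ (f x) b) (b-to (trans (adj-sym F i x) xy))
    ... | no x≢i | no y≢i rewrite g-off x≢i | g-off y≢i = f-edges x y xy

module _ {n} (G : Graph n) (A S B : Subset n) (A#S : Disjoint A S) (A#B : Disjoint A B)
  (B-complete : ∀ b → b ∈ₛ B → CompleteTo G b S) where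

  private
    G′ : Graph n
    G′ = (A ⟶ S within G) A#S

  ⟶-preserves-Free : ∀ {k} (F : Graph k) → k ≤ ∣ B ∣ → Free F G → Free F G′
  ⟶-preserves-Free {k} F k≤∣B∣ F-free (f , f-inj , f-edges) =
    F-free (evict k f f-inj f-edges (λ i _ → toℕ<n i))
    where
    evict : ∀ m (f : Fin k → Fin n) → Injective _≡_ _≡_ f → PreservesEdges F G′ f →
      (∀ i → f i ∈ₛ A → toℕ i < m) → Copy F G
    evict zero f f-inj f-edges bound =
      copy-of-⟶ G A S A#S F f f-inj f-edges (λ i fi∈A → contradiction (bound i fi∈A) λ ())
    evict (suc m) f f-inj f-edges bound
      with any? (λ i → (toℕ i ℕ.≟ m) ×-dec (lookup A (f i) Bool.≟ true))
    ... | no ∄ = evict m f f-inj f-edges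
      λ i fi∈A → ≤∧≢⇒< (m<1+n⇒m≤n (bound i fi∈A)) (λ i≡m → ∄ (i , i≡m , fi∈A))
    ... | yes (i , i≡m , fi∈A) = evict m g (proj₁ g-copy) (proj₂ g-copy) g-bound
      where
      b-avoiding : ∃ λ b → b ∈ₛ B × (∀ j → j ≢ i → f j ≢ b)
      b-avoiding = ∃-member-avoiding B f i k≤∣B∣
      b : Fin n
      b = proj₁ b-avoiding
      b∈B : b ∈ₛ B
      b∈B = proj₁ (proj₂ b-avoiding)
      b∉A : lookup A b ≡ false
      b∉A = ¬-not λ b∈A → A#B b b∈A b∈B
      b-complete′ : CompleteTo G′ b S
      b-complete′ s s∈S = trans (adj-⟶-outside G A S A#S b∉A (Disjoint⇒∉ˡ A S A#S s∈S))
        (B-complete b b∈B s s∈S)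
      g : Fin k → Fin n
      g = updateAt f i (const b)
      g-copy : Injective _≡_ _≡_ g × PreservesEdges F G′ g
      g-copy = copy-move G A S A#S F f f-inj f-edges i fi∈A b b-complete′
        (proj₂ (proj₂ b-avoiding))
      g-bound : ∀ j → g j ∈ₛ A → toℕ j < m
      g-bound j gj∈A with j ≟ i
      ... | yes refl = contradiction
        (trans (sym b∉A) (trans (cong (lookup A) (sym (updateAt-updates i f))) gj∈A)) λ ()
      ... | no j≢i = ≤∧≢⇒< (m<1+n⇒m≤n (bound j fj∈A))
        (λ j≡m → j≢i (toℕ-injective (trans j≡m (sym i≡m))))
        where
        fj∈A : f j ∈ₛ A
        fj∈A = trans (cong (lookup A) (sym (updateAt-minimal j i f j≢i))) gj∈A

∈nbhd⇒adj : ∀ {n} (G : Graph n) {u x} → x ∈ₛ nbhd G u → adj G u x ≡ true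
∈nbhd⇒adj G {u} {x} x∈N = trans (sym (lookup∘tabulate (adj G u) x)) x∈N

K-adj : ∀ {t} {i j : Fin t} → i ≢ j → adj (K t) i j ≡ true
K-adj {i = i} {j} i≢j with i ≟ j
... | yes i≡j = contradiction i≡j i≢j
... | no _    = refl

module _ {n} (G : Graph n) (A : Subset n) {u : Fin n} (u∈A : u ∈ₛ A)
  (A#N : Disjoint A (nbhd G u)) where

  private
    N : Subset n
    N = nbhd G u
    G′ : Graph n
    G′ = (A ⟶ N within G) A#N

  ⟶-nbhd-preserves-K-Free : ∀ t → Free (K t) G → Free (K t) G′
  ⟶-nbhd-preserves-K-Free t Kt-free (f , f-inj , f-edges)
    with any? (λ j → lookup A (f j) Bool.≟ true)
  ... | no ∄ =
    Kt-free (copy-of-⟶ G A N A#N (K t) f f-inj f-edges λ j fj∈A → contradiction (j , fj∈A) ∄)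
  ... | yes (i , fi∈A) =
    Kt-free (copy-of-⟶ G A N A#N (K t) g (proj₁ g-copy) (proj₂ g-copy) g-A-complete)
    where
    f-in-N : ∀ j → j ≢ i → f j ∈ₛ N
    f-in-N j j≢i = adj-⟶-from-A G A N A#N fi∈A (f-edges i j (K-adj (j≢i ∘ sym)))
    f≢u : ∀ j → j ≢ i → f j ≢ u
    f≢u j j≢i fj≡u = contradiction
      (trans (sym (adj-irr G u)) (∈nbhd⇒adj G (subst (_∈ₛ N) fj≡u (f-in-N j j≢i)))) λ ()
    u-complete : CompleteTo G u N
    u-complete s = ∈nbhd⇒adj G
    g : Fin t → Fin n
    g = updateAt f i (const u)
    g-copy : Injective _≡_ _≡_ g × PreservesEdges (K t) G′ g
    g-copy = copy-move G A N A#N (K t) f f-inj f-edges i fi∈A u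
      (λ s → adj-⟶-A-S G A N A#N u∈A) f≢u
    g-A-complete : ∀ j → g j ∈ₛ A → CompleteTo G (g j) N
    g-A-complete j gj∈A with j ≟ i
    ... | yes refl = subst (λ v → CompleteTo G v N) (sym (updateAt-updates i f)) u-complete
    ... | no j≢i = contradiction
      (subst (_∈ₛ N) (sym (updateAt-minimal j i f j≢i)) (f-in-N j j≢i)) (A#N (g j) gj∈A)

proposition3p2 : ∀ {n r : ℕ} (G : Graph n) (p : Fin n → Fin r) (hp : IsRPartition G p) →
    (∀ {k : ℕ} (F : Graph k) → ChromaticAtLeast3 F → Free F G →
      ∀ (A B : Subset n) →
      Independent G A → Independent G B → Disjoint A B → k ≤ ∣ B ∣ →
      Free F ((A ⟶ (commonNbhd G B ∩ ∁ A) within G)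
                (diffDisjoint A (commonNbhd G B))))
    × (∀ (t : ℕ) → Free (K t) G →
       ∀ (i : Fin r) (u : Fin n) (m : MaxDegIn G (part p i) u) →
       Free (K t) ((part p i ⟶ nbhd G u within G)
                   (nbhdDisjoint G (part p i) u (hp i) (proj₁ m))))
proposition3p2 G p hp =
  (λ F _ F-free A B _ _ A#B k≤∣B∣ →
    ⟶-preserves-Free G A (commonNbhd G B ∩ ∁ A) B (diffDisjoint A (commonNbhd G B)) A#B
      (λ b b∈B s → complete-to-commonNbhd G B b∈B s ∘ ∈ₛ-∩⁻ˡ (commonNbhd G B) (∁ A))
      F k≤∣B∣ F-free) ,
  (λ t Kt-free i u (u∈Vᵢ , _) →
    ⟶-nbhd-preserves-K-Free G (part p i) u∈Vᵢ (nbhdDisjoint G (part p i) u (hp i) u∈Vᵢ)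
      t Kt-free)
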